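{- Let $k\ge 3$. Let $U$ be a finite set with a partition $U=U_1\sqcup\cdots\sqcup U_t\sqcup\widetilde U$. If $\mathcal F\subseteq 2^{[t]}$ is $k$-cosunflower-free, then its blow-up $B(\mathcal F,\{U_i\}_{i=1}^t,\widetilde U)\subseteq 2^U$ is also $k$-cosunflower-free.
   Context: A collection of $k$ distinct sets $S_1,\dots,S_k$ is a $k$-cosunflower if $S_i\cup S_j=S_1\cup S_2$ for all $1\le i<j\le k$; a family is $k$-cosunflower-free if no $k$ distinct members form a $k$-cosunflower. Given the partition $U=U_1\sqcup\cdots\sqcup U_t\sqcup\widetilde U$ and $F\subseteq[t]$, the blow-up of $F$ is $B(F,\{U_i\},\widetilde U):=\{P\subseteq U : |P\cap U_i|=\mathbf 1_{i\in F}\text{ for all }i\in[t],\ P\cap\widetilde U=\varnothing\}$ (here $\mathbf 1_{i\in F}$ is $1$ if $i\in F$ and $0$ otherwise), and for $\mathcal F\subseteq 2^{[t]}$ the blow-up is $B(\mathcal F,\{U_i\},\widetilde U):=\bigcup_{F\in\mathcal F}B(F,\{U_i\},\widetilde U)$ (a disjoint union). -}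

module Defs where

open import Data.Nat using (ℕ; suc)
open import Data.Fin using (Fin; zero; suc)
import Data.Fin as F
open import Data.Fin.Subset using (Subset; _∪_; _∩_; ∣_∣; ⁅_⁆; ⊥)
open import Data.Maybe using (Maybe; just; nothing)
open import Data.Product using (Σ; _×_)
open import Data.Vec using (tabulate; lookup)
open import Data.Bool using (false; true; if_then_else_)
open import Data.Maybe using (maybe)
open import Relation.Nullary.Decidable using (⌊_⌋)
import Data.Empty as E
open import Relation.Binary.PropositionalEquality using (_≡_; _≢_)
open import Relation.Nullary using (¬_)

Family : ℕ → Set₁
Family m = Subset m → Set

-- Only meaningful for k ≥ 2 (the statement uses k ≥ 3); for
-- k < 2 we let the notion be vacuous (never holds).
IsCosunflower : ∀ {m} k → (Fin k → Subset m) → Set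
IsCosunflower 0 S = E.⊥
IsCosunflower 1 S = E.⊥
IsCosunflower (suc (suc k)) S =
  (∀ i j → i ≢ j → S i ≢ S j) ×
  (∀ i j → i F.< j → S i ∪ S j ≡ S zero ∪ S (suc zero))

CosunflowerFree : ∀ {m} → ℕ → Family m → Set
CosunflowerFree {m} k 𝓕 =
  ¬ (Σ (Fin k → Subset m) λ S → (∀ i → 𝓕 (S i)) × IsCosunflower k S)

-- Ground set U = Fin n with a partition U = U_1 ⊔ … ⊔ U_t ⊔ Ũ, encoded by
-- part : Fin n → Maybe (Fin t): part u = just i  iff u ∈ U_i,
--                                part u = nothing iff u ∈ Ũ.
Block : ∀ {n t} → (Fin n → Maybe (Fin t)) → Fin t → Subset n
Block part i = tabulate λ u → maybe (λ j → ⌊ j F.≟ i ⌋) false (part u)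

Tilde : ∀ {n t} → (Fin n → Maybe (Fin t)) → Subset n
Tilde part = tabulate λ u → maybe (λ _ → false) true (part u)

𝟙 : ∀ {t} → Fin t → Subset t → ℕ
𝟙 i F = if lookup F i then 1 else 0

InBlowup : ∀ {n t} → (Fin n → Maybe (Fin t)) → Subset t → Subset n → Set
InBlowup part F P =
  (∀ i → ∣ P ∩ Block part i ∣ ≡ 𝟙 i F) × (P ∩ Tilde part ≡ ⊥)

Blowup : ∀ {n t} → (Fin n → Maybe (Fin t)) → Family t → Family n
Blowup part 𝓕 P = Σ (Subset _) λ F → 𝓕 F × InBlowup part F P

-- A member P of the blow-up of F meets each block U_l in at most one point and
-- meets exactly the blocks l ∈ F, so F is recovered from P as the set of
-- blocks it meets, and the blocks met by P ∪ Q are those of F ∪ G. Hence the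
-- profiles of a blown-up cosunflower S_1, …, S_k satisfy the same union
-- identities. They are also distinct: if S_a ≠ S_b had the same profile, a
-- point u ∈ S_a ∖ S_b and the point v ∈ S_b of the same block would, via a
-- third petal S_m (this is where k ≥ 3 is used), both lie in S_a or both in
-- S_m, contradicting that each member meets a block at most once.
module Submission where

open import Defs
open import Data.Nat using (ℕ; suc; _+_; _≥_; _≤_; s≤s; z≤n)
import Data.Nat.Properties as ℕ
open import Data.Fin using (Fin; zero; suc; _≟_; _<_)
open import Data.Fin.Properties using (<-cmp)
open import Data.Fin.Subset
  using (Subset; _∈_; _∉_; _⊆_; _∪_; _∩_; ∣_∣; Nonempty)
open import Data.Fin.Subset.Properties
  using ( _∈?_; ∉⊥; ∣⊥∣≡0; nonempty?; Empty-unique; ⊆-antisym; ∪-comm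
        ; x∈p∩q⁺; x∈p∩q⁻; x∈p∪q⁺; x∈p∪q⁻; x∈p∧x≢y⇒x∈p-y; x∈p⇒∣p-x∣<∣p∣ )
open import Data.Bool using (true; false)
open import Data.Maybe using (Maybe; just; nothing; maybe)
open import Data.Product using (∃; _×_; _,_; proj₁; proj₂)
open import Data.Sum using (inj₁; inj₂)
open import Data.Vec using (lookup)
open import Data.Vec.Properties using ([]=⇒lookup; lookup⇒[]=; lookup∘tabulate)
open import Function using (_∘_)
open import Function.Bundles using (_⇔_; mk⇔; Equivalence)
open import Relation.Binary.Definitions using (tri<; tri≈; tri>)
open import Relation.Binary.PropositionalEquality
open import Relation.Nullary using (yes; no; contradiction)
open import Relation.Nullary.Decidable using (⌊_⌋; does; isYes≗does; dec-true)

open Equivalence using (to; from)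

private
  variable
    n t : ℕ

x∈p⇒1≤∣p∣ : ∀ {p : Subset n} {x} → x ∈ p → 1 ≤ ∣ p ∣
x∈p⇒1≤∣p∣ x∈p = ℕ.≤-trans (s≤s z≤n) (x∈p⇒∣p-x∣<∣p∣ x∈p)

1≤∣p∣⇒Nonempty : ∀ {p : Subset n} → 1 ≤ ∣ p ∣ → Nonempty p
1≤∣p∣⇒Nonempty {n} {p} 1≤∣p∣ with nonempty? p
... | yes ne = ne
... | no ¬ne = contradiction (subst (λ q → 1 ≤ ∣ q ∣) (Empty-unique ¬ne) 1≤∣p∣)
                             (λ 1≤∣⊥∣ → ℕ.<⇒≢ 1≤∣⊥∣ (sym (∣⊥∣≡0 n)))

∣p∣≤1⇒x∈p⇒y∈p⇒x≡y : ∀ {p : Subset n} → ∣ p ∣ ≤ 1 → ∀ {x y} → x ∈ p → y ∈ p → x ≡ y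
∣p∣≤1⇒x∈p⇒y∈p⇒x≡y ∣p∣≤1 {x} {y} x∈p y∈p with x ≟ y
... | yes x≡y = x≡y
... | no x≢y  = contradiction 2≤1 (ℕ.<-irrefl refl)
  where
  2≤1 : 2 ≤ 1
  2≤1 = ℕ.≤-trans (s≤s (x∈p⇒1≤∣p∣ (x∈p∧x≢y⇒x∈p-y y∈p (x≢y ∘ sym))))
                  (ℕ.≤-trans (x∈p⇒∣p-x∣<∣p∣ x∈p) ∣p∣≤1)

InjectiveOn : ∀ {A : Set} → (Fin n → A) → Subset n → Set
InjectiveOn f P = ∀ {u v} → u ∈ P → v ∈ P → f u ≡ f v → u ≡ v

-- A point u ∈ P outside Q lies in R since P ∪ Q = Q ∪ R, and its f-partner
-- v ∈ Q lies in P or R since P ∪ Q = P ∪ R; either way injectivity gives u = v.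
⊆-by-third-petal : ∀ {A : Set} (f : Fin n → A) {P Q R : Subset n}
  → P ∪ Q ≡ P ∪ R → P ∪ Q ≡ Q ∪ R → InjectiveOn f P → InjectiveOn f R
  → (∀ {u} → u ∈ P → ∃ λ v → v ∈ Q × f u ≡ f v) → P ⊆ Q
⊆-by-third-petal f {P} {Q} {R} PQ≡PR PQ≡QR f-inj-P f-inj-R partner {u} u∈P
  with partner u∈P
... | v , v∈Q , fu≡fv
  with x∈p∪q⁻ Q R (subst (u ∈_) PQ≡QR (x∈p∪q⁺ (inj₁ u∈P)))
... | inj₁ u∈Q = u∈Q
... | inj₂ u∈R
  with x∈p∪q⁻ P R (subst (v ∈_) PQ≡PR (x∈p∪q⁺ (inj₂ v∈Q)))
... | inj₁ v∈P = subst (_∈ Q) (sym (f-inj-P u∈P v∈P fu≡fv)) v∈Q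
... | inj₂ v∈R = subst (_∈ Q) (sym (f-inj-R u∈R v∈R fu≡fv)) v∈Q

𝟙-∈ : ∀ {l} {F : Subset t} → l ∈ F → 𝟙 l F ≡ 1
𝟙-∈ l∈F rewrite []=⇒lookup l∈F = refl

𝟙-∉ : ∀ {l} {F : Subset t} → l ∉ F → 𝟙 l F ≡ 0
𝟙-∉ {l = l} {F} l∉F with lookup F l in eq
... | true  = contradiction (lookup⇒[]= l F eq) l∉F
... | false = refl

module _ (part : Fin n → Maybe (Fin t)) where

  ∈Block⇒ : ∀ {u l} → u ∈ Block part l → part u ≡ just l
  ∈Block⇒ {u} {l} u∈Uₗ with part u | trans (sym (lookup∘tabulate _ u)) ([]=⇒lookup u∈Uₗ)
  ... | nothing | ()
  ... | just j  | ⌊j≟l⌋≡true with j ≟ l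
  ...   | yes j≡l = cong just j≡l
  ...   | no  _   with ⌊j≟l⌋≡true
  ...     | ()

  ⇒∈Block : ∀ {u l} → part u ≡ just l → u ∈ Block part l
  ⇒∈Block {u} {l} part-u≡l = lookup⇒[]= u _ (begin
    lookup (Block part l) u ≡⟨ lookup∘tabulate _ u ⟩
    maybe _ false (part u)  ≡⟨ cong (maybe _ false) part-u≡l ⟩
    ⌊ l ≟ l ⌋               ≡⟨ isYes≗does (l ≟ l) ⟩
    does (l ≟ l)            ≡⟨ dec-true (l ≟ l) refl ⟩
    true                    ∎)
    where open ≡-Reasoning

  ⇒∈Tilde : ∀ {u} → part u ≡ nothing → u ∈ Tilde part
  ⇒∈Tilde {u} part-u≡nothing =
    lookup⇒[]= u _ (trans (lookup∘tabulate _ u) (cong (maybe _ true) part-u≡nothing))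

  ProjectsOnto : Subset n → Subset t → Set
  ProjectsOnto P F = ∀ {l} → l ∈ F ⇔ (∃ λ u → u ∈ P × part u ≡ just l)

  ProjectsOnto-unique : ∀ {P F G} → ProjectsOnto P F → ProjectsOnto P G → F ≡ G
  ProjectsOnto-unique P↠F P↠G = ⊆-antisym (from P↠G ∘ to P↠F) (from P↠F ∘ to P↠G)

  ProjectsOnto-∪ : ∀ {P Q F G} → ProjectsOnto P F → ProjectsOnto Q G
    → ProjectsOnto (P ∪ Q) (F ∪ G)
  ProjectsOnto-∪ {P} {Q} {F} {G} P↠F Q↠G = mk⇔ blockMet blockHit
    where
    blockMet : ∀ {l} → l ∈ F ∪ G → ∃ λ u → u ∈ P ∪ Q × part u ≡ just l
    blockMet l∈F∪G with x∈p∪q⁻ F G l∈F∪G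
    ... | inj₁ l∈F = let u , u∈P , e = to P↠F l∈F in u , x∈p∪q⁺ (inj₁ u∈P) , e
    ... | inj₂ l∈G = let u , u∈Q , e = to Q↠G l∈G in u , x∈p∪q⁺ (inj₂ u∈Q) , e

    blockHit : ∀ {l} → (∃ λ u → u ∈ P ∪ Q × part u ≡ just l) → l ∈ F ∪ G
    blockHit (u , u∈P∪Q , e) with x∈p∪q⁻ P Q u∈P∪Q
    ... | inj₁ u∈P = x∈p∪q⁺ (inj₁ (from P↠F (u , u∈P , e)))
    ... | inj₂ u∈Q = x∈p∪q⁺ (inj₂ (from Q↠G (u , u∈Q , e)))

  module _ {F : Subset t} {P : Subset n} (P∈B[F] : InBlowup part F P) where

    private
      ∣P∩Uₗ∣≡𝟙 = proj₁ P∈B[F]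
      P∩Ũ≡∅     = proj₂ P∈B[F]

    InBlowup⇒inBlock : ∀ {u} → u ∈ P → ∃ λ l → part u ≡ just l
    InBlowup⇒inBlock {u} u∈P with part u in eq
    ... | just l  = l , refl
    ... | nothing = contradiction (subst (u ∈_) P∩Ũ≡∅ (x∈p∩q⁺ (u∈P , ⇒∈Tilde eq))) ∉⊥

    InBlowup⇒meets : ∀ {l} → l ∈ F → ∃ λ u → u ∈ P × part u ≡ just l
    InBlowup⇒meets {l} l∈F =
      let u , u∈P∩Uₗ = 1≤∣p∣⇒Nonempty (ℕ.≤-reflexive (sym ∣P∩Uₗ∣≡1))
          u∈P , u∈Uₗ = x∈p∩q⁻ P (Block part l) u∈P∩Uₗ
      in  u , u∈P , ∈Block⇒ u∈Uₗ
      where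
      ∣P∩Uₗ∣≡1 : ∣ P ∩ Block part l ∣ ≡ 1
      ∣P∩Uₗ∣≡1 = trans (∣P∩Uₗ∣≡𝟙 l) (𝟙-∈ l∈F)

    InBlowup⇒∈ : ∀ {l u} → u ∈ P → part u ≡ just l → l ∈ F
    InBlowup⇒∈ {l} {u} u∈P part-u≡l with l ∈? F
    ... | yes l∈F = l∈F
    ... | no  l∉F = contradiction (x∈p⇒1≤∣p∣ (x∈p∩q⁺ (u∈P , ⇒∈Block part-u≡l)))
                      (λ 1≤∣P∩Uₗ∣ → ℕ.<⇒≢ 1≤∣P∩Uₗ∣ (sym (trans (∣P∩Uₗ∣≡𝟙 l) (𝟙-∉ l∉F))))

    InBlowup⇒ProjectsOnto : ProjectsOnto P F
    InBlowup⇒ProjectsOnto = mk⇔ InBlowup⇒meets (λ (_ , u∈P , e) → InBlowup⇒∈ u∈P e)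

    InBlowup⇒InjectiveOn : InjectiveOn part P
    InBlowup⇒InjectiveOn {u} {v} u∈P v∈P part-u≡part-v =
      ∣p∣≤1⇒x∈p⇒y∈p⇒x≡y ∣P∩Uₗ∣≤1 (x∈p∩q⁺ (u∈P , ⇒∈Block part-u≡l))
                                  (x∈p∩q⁺ (v∈P , ⇒∈Block (trans (sym part-u≡part-v) part-u≡l)))
      where
      l         = proj₁ (InBlowup⇒inBlock u∈P)
      part-u≡l  = proj₂ (InBlowup⇒inBlock u∈P)
      ∣P∩Uₗ∣≤1 : ∣ P ∩ Block part l ∣ ≤ 1
      ∣P∩Uₗ∣≤1 = ℕ.≤-reflexive (trans (∣P∩Uₗ∣≡𝟙 l) (𝟙-∈ (InBlowup⇒∈ u∈P part-u≡l)))

module _ {k} {S : Fin (2 + k) → Subset n} (S-cosunflower : IsCosunflower (2 + k) S) where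

  cosunflower-∪ : ∀ {i j} → i ≢ j → S i ∪ S j ≡ S zero ∪ S (suc zero)
  cosunflower-∪ {i} {j} i≢j with <-cmp i j
  ... | tri< i<j _ _ = proj₂ S-cosunflower i j i<j
  ... | tri≈ _ i≡j _ = contradiction i≡j i≢j
  ... | tri> _ _ j<i = trans (∪-comm (S i) (S j)) (proj₂ S-cosunflower j i j<i)

  cosunflower-∪-≡ : ∀ {i j i′ j′} → i ≢ j → i′ ≢ j′ → S i ∪ S j ≡ S i′ ∪ S j′
  cosunflower-∪-≡ i≢j i′≢j′ = trans (cosunflower-∪ i≢j) (sym (cosunflower-∪ i′≢j′))

avoid-two : ∀ {k} (a b : Fin (3 + k)) → ∃ λ m → a ≢ m × b ≢ m
avoid-two zero          zero          = suc zero       , (λ ()) , (λ ())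
avoid-two zero          (suc zero)    = suc (suc zero) , (λ ()) , (λ ())
avoid-two zero          (suc (suc _)) = suc zero       , (λ ()) , (λ ())
avoid-two (suc zero)    zero          = suc (suc zero) , (λ ()) , (λ ())
avoid-two (suc _)       (suc _)       = zero           , (λ ()) , (λ ())
avoid-two (suc (suc _)) zero          = suc zero       , (λ ()) , (λ ())

module _ (part : Fin n → Maybe (Fin t)) {k}
         {S : Fin (3 + k) → Subset n} {G : Fin (3 + k) → Subset t}
         (S∈B[G] : ∀ i → InBlowup part (G i) (S i)) (S-cosunflower : IsCosunflower (3 + k) S)
  where

  private
    S↠G : ∀ i → ProjectsOnto part (S i) (G i)
    S↠G i = InBlowup⇒ProjectsOnto part {G i} {S i} (S∈B[G] i)

    S-injective : ∀ i → InjectiveOn part (S i)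
    S-injective i = InBlowup⇒InjectiveOn part {G i} {S i} (S∈B[G] i)

    ∪-≡ : ∀ {i j i′ j′} → i ≢ j → i′ ≢ j′ → S i ∪ S j ≡ S i′ ∪ S j′
    ∪-≡ = cosunflower-∪-≡ S-cosunflower

  profile-⊆ : ∀ {a b} → a ≢ b → G a ≡ G b → S a ⊆ S b
  profile-⊆ {a} {b} a≢b Ga≡Gb =
    ⊆-by-third-petal part (∪-≡ a≢b a≢m) (∪-≡ a≢b b≢m)
      (S-injective a) (S-injective m) partner
    where
    m   = proj₁ (avoid-two a b)
    a≢m = proj₁ (proj₂ (avoid-two a b))
    b≢m = proj₂ (proj₂ (avoid-two a b))

    partner : ∀ {u} → u ∈ S a → ∃ λ v → v ∈ S b × part u ≡ part v
    partner u∈Sa =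
      let l , part-u≡l = InBlowup⇒inBlock part {G a} (S∈B[G] a) u∈Sa
          v , v∈Sb , part-v≡l = to (S↠G b) (subst (l ∈_) Ga≡Gb (from (S↠G a) (_ , u∈Sa , part-u≡l)))
      in  v , v∈Sb , trans part-u≡l (sym part-v≡l)

  profiles-cosunflower : IsCosunflower (3 + k) G
  profiles-cosunflower = G-distinct , G-∪
    where
    G-distinct : ∀ i j → i ≢ j → G i ≢ G j
    G-distinct i j i≢j Gi≡Gj =
      proj₁ S-cosunflower i j i≢j (⊆-antisym (profile-⊆ i≢j Gi≡Gj) (profile-⊆ (i≢j ∘ sym) (sym Gi≡Gj)))

    G-∪ : ∀ i j → i < j → G i ∪ G j ≡ G zero ∪ G (suc zero)
    G-∪ i j i<j = ProjectsOnto-unique part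
      (ProjectsOnto-∪ part (S↠G i) (S↠G j))
      (subst (λ X → ProjectsOnto part X (G zero ∪ G (suc zero)))
             (sym (proj₂ S-cosunflower i j i<j))
             (ProjectsOnto-∪ part (S↠G zero) (S↠G (suc zero))))

proposition5p3 : (k n t : ℕ) → k ≥ 3 → (part : Fin n → Maybe (Fin t)) → (𝓕 : Family t)
    → CosunflowerFree k 𝓕 → CosunflowerFree k (Blowup part 𝓕)
proposition5p3 (suc (suc (suc k))) n t (s≤s (s≤s (s≤s z≤n))) part 𝓕 𝓕-free (S , S∈B[𝓕] , S-cosunflower) =
  𝓕-free (G , G∈𝓕 , profiles-cosunflower part S∈B[G] S-cosunflower)
  where
  G : Fin (3 + k) → Subset t
  G i = proj₁ (S∈B[𝓕] i)
  G∈𝓕 : ∀ i → 𝓕 (G i)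
  G∈𝓕 i = proj₁ (proj₂ (S∈B[𝓕] i))
  S∈B[G] : ∀ i → InBlowup part (G i) (S i)
  S∈B[G] i = proj₂ (proj₂ (S∈B[𝓕] i))
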